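{- Let $A$ be a meet-complemented lattice. If $Da$ exists for every $a\in A$, then $\Diamond a$ exists for every $a\in A$ and $\Diamond a=D\neg a$ for every $a\in A$.
   Context: A meet-complemented lattice is a lattice $(A,\wedge,\vee)$, not necessarily distributive, such that for every $a\in A$ the element $\neg a=\max\{b\in A: a\wedge b\le c\text{ for all }c\in A\}$ exists; it is bounded, with least element $0$ and greatest element $1$. For $a\in A$, $\Diamond a$ denotes $\min\{b\in A: \neg a\vee b=1\}$ and $Da$ denotes the least $b\in A$ with $a\vee b=1$, when these exist. -}

module Defs where

open import Level using (Level; _⊔_)
open import Data.Product using (Σ; _×_; proj₁)
open import Relation.Binary.Lattice.Bundles using (BoundedLattice)

module _ {c ℓ₁ ℓ₂ : Level} (L : BoundedLattice c ℓ₁ ℓ₂) where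
  open BoundedLattice L

  IsGreatest : (Carrier → Set (c ⊔ ℓ₁ ⊔ ℓ₂)) → Carrier → Set (c ⊔ ℓ₁ ⊔ ℓ₂)
  IsGreatest P x = P x × (∀ y → P y → y ≤ x)

  IsLeast : (Carrier → Set (c ⊔ ℓ₁ ⊔ ℓ₂)) → Carrier → Set (c ⊔ ℓ₁ ⊔ ℓ₂)
  IsLeast P x = P x × (∀ y → P y → x ≤ y)

  MeetBottom : Carrier → Carrier → Set (c ⊔ ℓ₁ ⊔ ℓ₂)
  MeetBottom a b = Level.Lift ℓ₁ (∀ z → (a ∧ b) ≤ z)

  JoinsToTop : Carrier → Carrier → Set (c ⊔ ℓ₁ ⊔ ℓ₂)
  JoinsToTop b d = Level.Lift (c ⊔ ℓ₂) ((b ∨ d) ≈ ⊤)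

  MeetComplemented : Set (c ⊔ ℓ₁ ⊔ ℓ₂)
  MeetComplemented = ∀ a → Σ Carrier (IsGreatest (MeetBottom a))

  neg : MeetComplemented → Carrier → Carrier
  neg mc a = proj₁ (mc a)

  IsD : Carrier → Carrier → Set (c ⊔ ℓ₁ ⊔ ℓ₂)
  IsD a = IsLeast (JoinsToTop a)

  IsDiamond : MeetComplemented → Carrier → Carrier → Set (c ⊔ ℓ₁ ⊔ ℓ₂)
  IsDiamond mc a = IsLeast (JoinsToTop (neg mc a))

module Submission where

open import Defs
open import Level using (Level)
open import Data.Product using (Σ; _×_; proj₁; proj₂; _,_)
open import Relation.Binary.Lattice.Bundles using (BoundedLattice)

module _ {c ℓ₁ ℓ₂ : Level} (L : BoundedLattice c ℓ₁ ℓ₂)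
         (mc : MeetComplemented L) where

  -- ◇a and D¬a are least elements of the same set {b : ¬a ∨ b = 1},
  -- so any element that is D¬a is also ◇a.
  diamond-is-D-neg : ∀ {a d} → IsD L (neg L mc a) d → IsDiamond L mc a d
  diamond-is-D-neg isD = isD

proposition7 : {c ℓ₁ ℓ₂ : Level} (L : BoundedLattice c ℓ₁ ℓ₂)
    (mc : MeetComplemented L)
    (hD : ∀ a → Σ (BoundedLattice.Carrier L) (IsD L a)) →
    ∀ a → Σ (BoundedLattice.Carrier L) (λ d →
    IsDiamond L mc a d × BoundedLattice._≈_ L d (proj₁ (hD (neg L mc a))))
proposition7 L mc hD a =
  D¬a , diamond-is-D-neg L mc (proj₂ (hD (neg L mc a))) , BoundedLattice.Eq.refl L
  where
    D¬a : BoundedLattice.Carrier L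
    D¬a = proj₁ (hD (neg L mc a))
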